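{- There are infinitely many pairs of different tetrahedral numbers whose product is the square of an integer; i.e., there are infinitely many pairs of positive integers $x \neq y$ such that $T_x T_y = z^2$ for some integer $z$.
   Context: $T_n = \frac{n(n+1)(n+2)}{6}$ denotes the $n$-th tetrahedral number. -}

module Defs where

open import Data.Nat using (ℕ; suc; _*_; _+_)
open import Data.Nat.DivMod using (_/_)

T : ℕ → ℕ
T n = (n * (n + 1) * (n + 2)) / 6

module Submission where

-- Since 6 · T n = n(n+1)(n+2), for every a
--   T (6a+2) · T (3a) = a(2a+1) · ((3a+1)(3a+2))²,
-- because T (6a+2) = 2(3a+1)(2a+1)(3a+2) and T (3a) = a(3a+1)(3a+2)/2.
-- Hence every solution of the Diophantine equation  b² = a(2a+1)  yields
-- the square product T (6a+2) · T (3a) = (b(3a+1)(3a+2))², with 6a+2 ≠ 3a.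
-- The equation has infinitely many solutions: starting from (0,0) the map
--   (a , b) ↦ (17a + 12b + 4 , 24a + 17b + 6)
-- preserves it and strictly increases a (it is multiplication by the unit
-- (3 + 2√2)² = 17 + 12√2 acting on the Pell equation (4a+1)² − 8b² = 1).

open import Defs
open import Data.Nat using (ℕ; zero; suc; _+_; _*_; _<_; _≤_; z≤n; s≤s)
open import Data.Nat.Properties
  using (*-cancelˡ-≡; +-cancelʳ-≡; ≤-trans; ≤-reflexive; m≤m+n; <⇒≢)
open import Data.Nat.Divisibility using (_∣_; ∣m∣n⇒∣m+n; n∣m*n; *-monoʳ-∣)
open import Data.Nat.DivMod using (m*[n/m]≡n)
open import Data.Nat.Tactic.RingSolver using (solve-∀)
open import Data.Product using (∃-syntax; _×_; _,_)
open import Relation.Binary.PropositionalEquality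
  using (_≡_; _≢_; refl; sym; cong; cong₂; subst; module ≡-Reasoning)

open ≡-Reasoning

two∣consecutive : ∀ m → 2 ∣ m * (m + 1)
two∣consecutive zero    = n∣m*n 0
two∣consecutive (suc m) =
  subst (2 ∣_) (sym (shift m)) (∣m∣n⇒∣m+n (two∣consecutive m) (n∣m*n (m + 1)))
  where
  shift : ∀ m → suc m * (suc m + 1) ≡ m * (m + 1) + (m + 1) * 2
  shift = solve-∀

six∣consecutive : ∀ m → 6 ∣ m * (m + 1) * (m + 2)
six∣consecutive zero    = n∣m*n 0
six∣consecutive (suc m) =
  subst (6 ∣_) (sym (shift m))
    (∣m∣n⇒∣m+n (six∣consecutive m) (*-monoʳ-∣ 3 (two∣consecutive (suc m))))
  where
  shift : ∀ m → suc m * (suc m + 1) * (suc m + 2)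
              ≡ m * (m + 1) * (m + 2) + 3 * (suc m * (suc m + 1))
  shift = solve-∀

six*T : ∀ n → 6 * T n ≡ n * (n + 1) * (n + 2)
six*T n = m*[n/m]≡n (six∣consecutive n)

T-product : ∀ a → T (6 * a + 2) * T (3 * a)
                  ≡ a * (2 * a + 1) * ((3 * a + 1) * (3 * a + 2) * ((3 * a + 1) * (3 * a + 2)))
T-product a = *-cancelˡ-≡ _ _ 36 (begin
    36 * (T x * T y)                                  ≡⟨ regroup (T x) (T y) ⟩
    6 * T x * (6 * T y)                               ≡⟨ cong₂ _*_ (six*T x) (six*T y) ⟩
    x * (x + 1) * (x + 2) * (y * (y + 1) * (y + 2))   ≡⟨ expand a ⟩
    36 * (a * (2 * a + 1) * (c * c))                  ∎)
  where
  x = 6 * a + 2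
  y = 3 * a
  c = (3 * a + 1) * (3 * a + 2)
  regroup : ∀ p q → 36 * (p * q) ≡ 6 * p * (6 * q)
  regroup = solve-∀
  expand : ∀ a → (6 * a + 2) * (6 * a + 2 + 1) * (6 * a + 2 + 2)
                   * (3 * a * (3 * a + 1) * (3 * a + 2))
                 ≡ 36 * (a * (2 * a + 1) * ((3 * a + 1) * (3 * a + 2) * ((3 * a + 1) * (3 * a + 2))))
  expand = solve-∀

record Solution : Set where
  constructor solution
  field
    a b : ℕ
    equation : b * b ≡ a * (2 * a + 1)

square-product : (s : Solution) → let open Solution s in
  T (6 * a + 2) * T (3 * a) ≡ b * ((3 * a + 1) * (3 * a + 2)) * (b * ((3 * a + 1) * (3 * a + 2)))
square-product (solution a b eq) = begin
  T (6 * a + 2) * T (3 * a)        ≡⟨ T-product a ⟩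
  a * (2 * a + 1) * (c * c)        ≡⟨ cong (λ u → u * (c * c)) (sym eq) ⟩
  b * b * (c * c)                  ≡⟨ interchange b c ⟩
  b * c * (b * c)                  ∎
  where
  c = (3 * a + 1) * (3 * a + 2)
  interchange : ∀ b c → b * b * (c * c) ≡ b * c * (b * c)
  interchange = solve-∀

next-a : ℕ → ℕ → ℕ
next-a a b = 17 * a + 12 * b + 4

next : Solution → Solution
next (solution a b eq) = solution A B (+-cancelʳ-≡ (a * (2 * a + 1)) (B * B) (A * (2 * A + 1)) (begin
    B * B + a * (2 * a + 1)       ≡⟨ invariant a b ⟩
    A * (2 * A + 1) + b * b       ≡⟨ cong (A * (2 * A + 1) +_) eq ⟩
    A * (2 * A + 1) + a * (2 * a + 1) ∎))
  where
  A = next-a a b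
  B = 24 * a + 17 * b + 6
  invariant : ∀ a b → (24 * a + 17 * b + 6) * (24 * a + 17 * b + 6) + a * (2 * a + 1)
                      ≡ (17 * a + 12 * b + 4) * (2 * (17 * a + 12 * b + 4) + 1) + b * b
  invariant = solve-∀

a<next-a : ∀ a b → a < next-a a b
a<next-a a b = ≤-trans (s≤s (m≤m+n a (16 * a + 12 * b + 3))) (≤-reflexive (rearrange a b))
  where
  rearrange : ∀ a b → suc (a + (16 * a + 12 * b + 3)) ≡ 17 * a + 12 * b + 4
  rearrange = solve-∀

solutions : ℕ → Solution
solutions zero    = solution 0 0 refl
solutions (suc n) = next (solutions n)

solutions-unbounded : ∀ n → n ≤ Solution.a (solutions n)
solutions-unbounded zero    = z≤n
solutions-unbounded (suc n) with solutions n | solutions-unbounded n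
... | solution a b _ | n≤a = ≤-trans (s≤s n≤a) (a<next-a a b)

pair-from-solution : ∀ N (s : Solution) → N < Solution.a s → ∃[ x ] ∃[ y ] ∃[ z ]
    (N < x × 0 < y × x ≢ y × T x * T y ≡ z * z)
pair-from-solution N s@(solution a b _) N<a =
  6 * a + 2 , 3 * a , b * ((3 * a + 1) * (3 * a + 2)) ,
  ≤-trans N<a (≤-trans (m≤m+n a (5 * a + 2)) (≤-reflexive (split a))) ,
  ≤-trans (s≤s z≤n) (≤-trans N<a (m≤m+n a (2 * a))) ,
  (λ eq → <⇒≢ (3a<6a+2 a) (sym eq)) ,
  square-product s
  where
  split : ∀ a → a + (5 * a + 2) ≡ 6 * a + 2
  split = solve-∀
  3a<6a+2 : ∀ a → 3 * a < 6 * a + 2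
  3a<6a+2 a = ≤-trans (s≤s (m≤m+n (3 * a) (3 * a + 1))) (≤-reflexive (grow a))
    where
    grow : ∀ a → suc (3 * a + (3 * a + 1)) ≡ 6 * a + 2
    grow = solve-∀

theorem5p6 : ∀ (N : ℕ) → ∃[ x ] ∃[ y ] ∃[ z ]
    (N < x × 0 < y × x ≢ y × T x * T y ≡ z * z)
theorem5p6 N = pair-from-solution N (solutions (suc N)) (solutions-unbounded (suc N))
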